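{- Let $(M_n)_{n\ge1}$, $M_n=(f_n(m,k))_{1\le m,k\le 2n}$, be the Delta sequence. Then for all $n\ge1$ and $2\le k\le 2n-1$, $$f_n(k+1,k-1)+f_n(k-1,k+1)=f_n(k+1,k)+f_n(k-1,k)=f_n(k,k+1)+f_n(k,k-1).$$
   Context: Delta sequence. For $n\ge1$, $M_n=(f_n(m,k))_{1\le m,k\le 2n}$ is a $2n\times 2n$ matrix; by convention $f_n(m,k)=0$ if $(m,k)\notin[1,2n]^2$. Write $f_n(m,\bullet)=\sum_{k=1}^{2n}f_n(m,k)$ and $f_n(\bullet,k)=\sum_{m=1}^{2n}f_n(m,k)$. Let $L_n^{(1)}=\{(m,k):2\le k+1\le m\le 2n-2\}$ and $U_n^{(1)}=\{(m,k):2\le m+1\le k\le 2n-2\}$. The Delta sequence is the unique sequence $(M_n)_{n\ge1}$ of matrices with nonnegative integer entries such that $M_1=\begin{pmatrix}0&0\\1&0\end{pmatrix}$ and, for every $n\ge2$: (a) $f_n(m,m)=0$ for all $m$; (b) $f_n(m+2,k)-2f_n(m+1,k)+f_n(m,k)+2f_{n-1}(m,k)=0$ for $(m,k)\in L_n^{(1)}$; (c) $f_n(m,k+2)-2f_n(m,k+1)+f_n(m,k)+2f_{n-1}(m,k)=0$ for $(m,k)\in U_n^{(1)}$; (d) column $2n$ of $M_n$ is zero, and column $2n-1$ is $(f_{n-1}(1,\bullet),\dots,f_{n-1}(2n-2,\bullet),0,0)$ read top to bottom; (e) row $2n$ of $M_n$ is $(f_{n-1}(1,\bullet),\dots,f_{n-1}(2n-2,\bullet),0,0)$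 read left to right, and row $2n-1$ is $(f_{n-1}(1,\bullet)+f_{n-1}(\bullet,1),\dots,f_{n-1}(2n-2,\bullet)+f_{n-1}(\bullet,2n-2),0,0)$. (These conditions determine the sequence uniquely.) -}

module Defs where

open import Data.Nat using (ℕ; zero; suc; _+_; _*_; _∸_; _≤_; _<_)
open import Data.Product using (_×_)
open import Relation.Nullary using (¬_)
open import Relation.Binary.PropositionalEquality using (_≡_)

-- A candidate sequence of matrices: Entries f n m k = f_n(m,k), for all
-- natural numbers n, m, k (indices outside [1,2n]^2 must be 0, see IsDelta).
Entries : Set
Entries = ℕ → ℕ → ℕ → ℕ

sumTo : ℕ → (ℕ → ℕ) → ℕ
sumTo zero    g = 0
sumTo (suc j) g = sumTo j g + g (suc j)

rowSum : Entries → ℕ → ℕ → ℕ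
rowSum f n m = sumTo (2 * n) (λ k → f n m k)

colSum : Entries → ℕ → ℕ → ℕ
colSum f n k = sumTo (2 * n) (λ m → f n m k)

InRange : ℕ → ℕ → ℕ → Set
InRange n m k = (1 ≤ m × m ≤ 2 * n) × (1 ≤ k × k ≤ 2 * n)

-- The defining conditions of the Delta sequence (the context asserts a unique
-- such sequence exists).  The recurrences (b),(c) are stated in ℕ with the
-- negative terms moved to the other side.
record IsDelta (f : Entries) : Set where
  field
    outside : ∀ n m k → 1 ≤ n → ¬ InRange n m k → f n m k ≡ 0
    M1-11 : f 1 1 1 ≡ 0
    M1-12 : f 1 1 2 ≡ 0
    M1-21 : f 1 2 1 ≡ 1
    M1-22 : f 1 2 2 ≡ 0
    diag : ∀ n m → 2 ≤ n → f n m m ≡ 0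
    -- (b) on L_n^(1) = {(m,k) : 2 ≤ k+1 ≤ m ≤ 2n-2}
    recL : ∀ n m k → 2 ≤ n → 2 ≤ k + 1 → k + 1 ≤ m → m ≤ 2 * n ∸ 2 →
           f n (m + 2) k + f n m k + 2 * f (n ∸ 1) m k ≡ 2 * f n (m + 1) k
    -- (c) on U_n^(1) = {(m,k) : 2 ≤ m+1 ≤ k ≤ 2n-2}
    recU : ∀ n m k → 2 ≤ n → 2 ≤ m + 1 → m + 1 ≤ k → k ≤ 2 * n ∸ 2 →
           f n m (k + 2) + f n m k + 2 * f (n ∸ 1) m k ≡ 2 * f n m (k + 1)
    col2n : ∀ n m → 2 ≤ n → f n m (2 * n) ≡ 0
    -- (d) column 2n-1 is (f_{n-1}(1,•), …, f_{n-1}(2n-2,•), 0, 0)^T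
    col2n-1 : ∀ n m → 2 ≤ n → m ≤ 2 * n ∸ 2 →
              f n m (2 * n ∸ 1) ≡ rowSum f (n ∸ 1) m
    col2n-1-low1 : ∀ n → 2 ≤ n → f n (2 * n ∸ 1) (2 * n ∸ 1) ≡ 0
    col2n-1-low2 : ∀ n → 2 ≤ n → f n (2 * n) (2 * n ∸ 1) ≡ 0
    -- (e) row 2n is (f_{n-1}(1,•), …, f_{n-1}(2n-2,•), 0, 0)
    row2n : ∀ n k → 2 ≤ n → k ≤ 2 * n ∸ 2 →
            f n (2 * n) k ≡ rowSum f (n ∸ 1) k
    row2n-last1 : ∀ n → 2 ≤ n → f n (2 * n) (2 * n ∸ 1) ≡ 0
    row2n-last2 : ∀ n → 2 ≤ n → f n (2 * n) (2 * n) ≡ 0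
    -- (e) row 2n-1 is (f_{n-1}(1,•)+f_{n-1}(•,1), …, f_{n-1}(2n-2,•)+f_{n-1}(•,2n-2), 0, 0)
    row2n-1 : ∀ n k → 2 ≤ n → k ≤ 2 * n ∸ 2 →
              f n (2 * n ∸ 1) k ≡ rowSum f (n ∸ 1) k + colSum f (n ∸ 1) k
    row2n-1-last1 : ∀ n → 2 ≤ n → f n (2 * n ∸ 1) (2 * n ∸ 1) ≡ 0
    row2n-1-last2 : ∀ n → 2 ≤ n → f n (2 * n ∸ 1) (2 * n) ≡ 0

module Submission where

-- Entries are handled as integers; r_n, c_n are the row and column sums and
-- w_n(d) = f_n(2n,d) is the last row, which by (e) is the row-sum sequence r_{n−1}.
-- The proof is an induction on n carrying an invariant of M_n whose core is
--   below:  f_n(m,k) = f_n(k,m) + w_n(m−k)                    (k < m),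
--   above:  f_n(m+1,k) + f_n(m,k−1) = 2 f_n(m,k) + w_n(k−m)     (m+2 ≤ k),
-- together with auxiliary facts on row 1, column 2n and the row/column sums.
-- Each entry identity at level N+1 is a uniqueness argument: its defect along a
-- row or column has vanishing second difference (recurrences (b), (c) and the
-- invariant at level N) and vanishes at the last two indices (conditions (d),
-- (e)), hence vanishes everywhere (Δ²-backward-zero).  The sum identities at
-- level N+1 then follow from the entry identities by telescoping sums.  Since
-- w_n(1) = r_{n−1}(1) = 0, the theorem is 'below' at (k+1,k−1), (k+1,k), (k,k−1)
-- combined with 'above' at (k−1,k+1).

open import Defs
open import Data.Nat using (ℕ; _+_; _*_; _∸_; _≤_)
open import Data.Product using (_×_)
open import Relation.Binary.PropositionalEquality using (_≡_)

open import Data.Nat using (zero; suc; _<_; z≤n; s≤s)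
import Data.Nat.Properties as ℕP
open import Data.Integer using (ℤ; +_; 0ℤ) renaming (_+_ to _⊕_; _-_ to _⊖_; -_ to ⊝_)
import Data.Integer.Properties as ℤP
open import Data.Integer.Tactic.RingSolver using (solve-∀)
open import Data.Product using (_,_; proj₁)
open import Data.Sum using (inj₁; inj₂)
open import Data.Empty using (⊥-elim)
open import Function using (_∘_)
open import Relation.Binary.Definitions using (tri<; tri≈; tri>)
open import Relation.Binary.PropositionalEquality
  using (refl; sym; trans; cong; cong₂; subst; subst₂; module ≡-Reasoning)

sumℤ : ℕ → (ℕ → ℤ) → ℤ
sumℤ zero    h = 0ℤ
sumℤ (suc j) h = sumℤ j h ⊕ h (suc j)

sumℤ-cast : ∀ j (g : ℕ → ℕ) → + sumTo j g ≡ sumℤ j (λ i → + g i)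
sumℤ-cast zero    g = refl
sumℤ-cast (suc j) g =
  trans (ℤP.pos-+ (sumTo j g) (g (suc j))) (cong (_⊕ + g (suc j)) (sumℤ-cast j g))

sumℤ-cong : ∀ j {h h′ : ℕ → ℤ} → (∀ i → 1 ≤ i → i ≤ j → h i ≡ h′ i) → sumℤ j h ≡ sumℤ j h′
sumℤ-cong zero    eq = refl
sumℤ-cong (suc j) eq =
  cong₂ _⊕_ (sumℤ-cong j (λ i 1≤i i≤j → eq i 1≤i (ℕP.m≤n⇒m≤1+n i≤j))) (eq (suc j) (s≤s z≤n) ℕP.≤-refl)

sumℤ-zero : ∀ j {h : ℕ → ℤ} → (∀ i → 1 ≤ i → i ≤ j → h i ≡ 0ℤ) → sumℤ j h ≡ 0ℤ
sumℤ-zero zero    eq = refl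
sumℤ-zero (suc j) eq
  rewrite sumℤ-zero j (λ i 1≤i i≤j → eq i 1≤i (ℕP.m≤n⇒m≤1+n i≤j)) | eq (suc j) (s≤s z≤n) ℕP.≤-refl = refl

sumℤ-⊕ : ∀ j (h h′ : ℕ → ℤ) → sumℤ j (λ i → h i ⊕ h′ i) ≡ sumℤ j h ⊕ sumℤ j h′
sumℤ-⊕ zero    h h′ = refl
sumℤ-⊕ (suc j) h h′ rewrite sumℤ-⊕ j h h′ =
  interchange (sumℤ j h) (sumℤ j h′) (h (suc j)) (h′ (suc j))
  where
  interchange : ∀ a b c d → (a ⊕ b) ⊕ (c ⊕ d) ≡ (a ⊕ c) ⊕ (b ⊕ d)
  interchange = solve-∀

sumℤ-⊖ : ∀ j (h h′ : ℕ → ℤ) → sumℤ j (λ i → h i ⊖ h′ i) ≡ sumℤ j h ⊖ sumℤ j h′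
sumℤ-⊖ zero    h h′ = refl
sumℤ-⊖ (suc j) h h′ rewrite sumℤ-⊖ j h h′ =
  interchange (sumℤ j h) (sumℤ j h′) (h (suc j)) (h′ (suc j))
  where
  interchange : ∀ a b c d → (a ⊖ b) ⊕ (c ⊖ d) ≡ (a ⊕ c) ⊖ (b ⊕ d)
  interchange = solve-∀

sumℤ-telescope : ∀ j (P : ℕ → ℤ) → sumℤ j (λ i → P i ⊖ P (i ∸ 1)) ≡ P j ⊖ P 0
sumℤ-telescope zero    P = sym (ℤP.+-inverseʳ (P 0))
sumℤ-telescope (suc j) P rewrite sumℤ-telescope j P = chain (P j) (P 0) (P (suc j))
  where
  chain : ∀ a b c → (a ⊖ b) ⊕ (c ⊖ a) ≡ c ⊖ b
  chain = solve-∀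

twice : ℤ → ℤ
twice x = x ⊕ x

Δ² : (ℕ → ℤ) → ℕ → ℤ
Δ² X m = (X m ⊕ X (suc (suc m))) ⊖ twice (X (suc m))

Δ²-⊕ : ∀ (X Y : ℕ → ℤ) m → Δ² (λ i → X i ⊕ Y i) m ≡ Δ² X m ⊕ Δ² Y m
Δ²-⊕ X Y m = linear (X m) (X (suc m)) (X (suc (suc m))) (Y m) (Y (suc m)) (Y (suc (suc m)))
  where
  linear : ∀ a b c a′ b′ c′ →
    ((a ⊕ a′) ⊕ (c ⊕ c′)) ⊖ ((b ⊕ b′) ⊕ (b ⊕ b′)) ≡
    ((a ⊕ c) ⊖ (b ⊕ b)) ⊕ ((a′ ⊕ c′) ⊖ (b′ ⊕ b′))
  linear = solve-∀

Δ²-⊖ : ∀ (X Y : ℕ → ℤ) m → Δ² (λ i → X i ⊖ Y i) m ≡ Δ² X m ⊖ Δ² Y m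
Δ²-⊖ X Y m = linear (X m) (X (suc m)) (X (suc (suc m))) (Y m) (Y (suc m)) (Y (suc (suc m)))
  where
  linear : ∀ a b c a′ b′ c′ →
    ((a ⊖ a′) ⊕ (c ⊖ c′)) ⊖ ((b ⊖ b′) ⊕ (b ⊖ b′)) ≡
    ((a ⊕ c) ⊖ (b ⊕ b)) ⊖ ((a′ ⊕ c′) ⊖ (b′ ⊕ b′))
  linear = solve-∀

Δ²-twice : ∀ (X : ℕ → ℤ) m → Δ² (λ i → twice (X i)) m ≡ twice (Δ² X m)
Δ²-twice X m = linear (X m) (X (suc m)) (X (suc (suc m)))
  where
  linear : ∀ a b c →
    ((a ⊕ a) ⊕ (c ⊕ c)) ⊖ ((b ⊕ b) ⊕ (b ⊕ b)) ≡ ((a ⊕ c) ⊖ (b ⊕ b)) ⊕ ((a ⊕ c) ⊖ (b ⊕ b))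
  linear = solve-∀

Δ²-shift : ∀ (X : ℕ → ℤ) {k m} → k ≤ m → Δ² (λ i → X (i ∸ k)) m ≡ Δ² X (m ∸ k)
Δ²-shift X {k} k≤m rewrite ℕP.+-∸-assoc 2 k≤m | ℕP.+-∸-assoc 1 k≤m = refl

Δ²-reflect : ∀ (X : ℕ → ℤ) e m → Δ² (λ i → X ((suc (suc m) + e) ∸ i)) m ≡ Δ² X e
Δ²-reflect X e zero    = swap (X (suc (suc e))) (X e) (X (suc e))
  where
  swap : ∀ a b c → (a ⊕ b) ⊖ (c ⊕ c) ≡ (b ⊕ a) ⊖ (c ⊕ c)
  swap = solve-∀
Δ²-reflect X e (suc m) = Δ²-reflect X e m

Δ²-root : ∀ {x y z} → (x ⊕ z) ⊖ (y ⊕ y) ≡ 0ℤ → y ≡ 0ℤ → z ≡ 0ℤ → x ≡ 0ℤ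
Δ²-root {x} Δ²≡0 refl refl = trans (unit x) Δ²≡0
  where
  unit : ∀ x → x ≡ (x ⊕ 0ℤ) ⊖ (0ℤ ⊕ 0ℤ)
  unit = solve-∀

Δ²-backward-zero : (X : ℕ → ℤ) (a b : ℕ) → (a ≤ b → X b ≡ 0ℤ) → X (suc b) ≡ 0ℤ →
  (∀ m → a ≤ m → m < b → Δ² X m ≡ 0ℤ) → ∀ m → a ≤ m → m ≤ suc b → X m ≡ 0ℤ
Δ²-backward-zero X a b Xb Xb+1 harmonic m a≤m m≤b+1 with ℕP.m≤n⇒m<n∨m≡n m≤b+1
... | inj₂ refl        = Xb+1
... | inj₁ (s≤s m≤b) = proj₁ (downward (b ∸ m) m (ℕP.m+[n∸m]≡n m≤b) a≤m)
  where
  downward : ∀ d m → m + d ≡ b → a ≤ m → (X m ≡ 0ℤ) × (X (suc m) ≡ 0ℤ)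
  downward zero    m m≡b a≤m rewrite ℕP.+-identityʳ m | m≡b = Xb a≤m , Xb+1
  downward (suc d) m m+d+1≡b a≤m
    with downward d (suc m) (trans (sym (ℕP.+-suc m d)) m+d+1≡b) (ℕP.m≤n⇒m≤1+n a≤m)
  ... | Xm+1 , Xm+2 = Δ²-root (harmonic m a≤m m<b) Xm+1 Xm+2 , Xm+1
    where
    m<b : m < b
    m<b = subst (m <_) m+d+1≡b (ℕP.m<m+n m (s≤s z≤n))

from-difference : ∀ {s t p q : ℤ} → s ⊖ t ≡ p ⊖ q → p ≡ q → s ≡ t
from-difference {s} {t} key p≡q = ℤP.i-j≡0⇒i≡j s t (trans key (ℤP.i≡j⇒i-j≡0 p≡q))

difference-zero : ∀ {a b c : ℤ} → (a ⊖ b) ⊖ c ≡ 0ℤ → a ≡ b ⊕ c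
difference-zero {a} {b} {c} eq = from-difference (regroup a b c) eq
  where
  regroup : ∀ a b c → a ⊖ (b ⊕ c) ≡ ((a ⊖ b) ⊖ c) ⊖ 0ℤ
  regroup = solve-∀

move-right : ∀ {a b q : ℤ} → a ⊖ b ≡ q → a ≡ b ⊕ q
move-right {a} {b} {q} eq = difference-zero (trans (cong (_⊖ q) eq) (ℤP.+-inverseʳ q))

scaled-zero : ∀ {x y : ℤ} → x ≡ y → ⊝ twice (x ⊖ y) ≡ 0ℤ
scaled-zero x≡y rewrite ℤP.i≡j⇒i-j≡0 x≡y = refl

recurrence-Δ² : ∀ {x y z g : ℕ} → z + x + 2 * g ≡ 2 * y → (+ x ⊕ + z) ⊖ twice (+ y) ≡ ⊝ twice (+ g)
recurrence-Δ² {x} {y} {z} {g} eq =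
  from-difference (rearrange (+ x) (+ y) (+ z) (+ g)) (cong +_ eq)
  where
  -- 2 * g unfolds to g + (g + 0)
  rearrange : ∀ x y z g →
    ((x ⊕ z) ⊖ (y ⊕ y)) ⊖ ⊝ (g ⊕ g) ≡ ((z ⊕ x) ⊕ (g ⊕ (g ⊕ 0ℤ))) ⊖ (y ⊕ (y ⊕ 0ℤ))
  rearrange = solve-∀

double-suc : ∀ N → 2 * suc N ≡ suc (suc (2 * N))
double-suc N = ℕP.*-suc 2 N

1≤∸ : ∀ {k i} → k < i → 1 ≤ i ∸ k
1≤∸ k<i = ℕP.m+n≤o⇒m≤o∸n 1 k<i

suc∸≤ : ∀ {k i} → 1 ≤ k → k ≤ i → suc (i ∸ k) ≤ i
suc∸≤ {k} {i} 1≤k k≤i = ℕP.∸-monoʳ-< {i} {k} {0} 1≤k k≤i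

module DeltaSequence (f : Entries) (delta : IsDelta f) where
  open IsDelta delta

  F : ℕ → ℕ → ℕ → ℤ
  F n m k = + f n m k

  r : ℕ → ℕ → ℤ
  r n m = sumℤ (2 * n) (F n m)

  c : ℕ → ℕ → ℤ
  c n k = sumℤ (2 * n) (λ m → F n m k)

  w : ℕ → ℕ → ℤ
  w n d = F n (2 * n) d

  rowSum-cast : ∀ n m → + rowSum f n m ≡ r n m
  rowSum-cast n m = sumℤ-cast (2 * n) (f n m)

  colSum-cast : ∀ n k → + colSum f n k ≡ c n k
  colSum-cast n k = sumℤ-cast (2 * n) (λ m → f n m k)

  F-row0 : ∀ {n} k → 1 ≤ n → F n 0 k ≡ 0ℤ
  F-row0 {n} k 1≤n = cong +_ (outside n 0 k 1≤n λ { ((() , _) , _) })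

  F-rowBeyond : ∀ {n m} k → 1 ≤ n → 2 * n < m → F n m k ≡ 0ℤ
  F-rowBeyond {n} {m} k 1≤n 2n<m =
    cong +_ (outside n m k 1≤n λ ((_ , m≤2n) , _) → ℕP.<⇒≱ 2n<m m≤2n)

  F-col0 : ∀ {n} m → 1 ≤ n → F n m 0 ≡ 0ℤ
  F-col0 {n} m 1≤n = cong +_ (outside n m 0 1≤n λ { (_ , (() , _)) })

  F-colBeyond : ∀ {n k} m → 1 ≤ n → 2 * n < k → F n m k ≡ 0ℤ
  F-colBeyond {n} {k} m 1≤n 2n<k =
    cong +_ (outside n m k 1≤n λ (_ , (_ , k≤2n)) → ℕP.<⇒≱ 2n<k k≤2n)

  r-row0 : ∀ {n} → 1 ≤ n → r n 0 ≡ 0ℤ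
  r-row0 {n} 1≤n = sumℤ-zero (2 * n) (λ k _ _ → F-row0 k 1≤n)

  r-beyond : ∀ {n d} → 1 ≤ n → 2 * n < d → r n d ≡ 0ℤ
  r-beyond {n} 1≤n 2n<d = sumℤ-zero (2 * n) (λ k _ _ → F-rowBeyond k 1≤n 2n<d)

  -- The theorem is a
  -- consequence of 'below' and 'above'; the other fields are what is needed to
  -- propagate those two from level n to level n+1.
  record Invariant (n : ℕ) : Set where
    field
      row1-zero    : ∀ k → F n 1 k ≡ 0ℤ
      lastCol-zero : ∀ m → F n m (2 * n) ≡ 0ℤ
      below        : ∀ m k → 1 ≤ k → k < m → m ≤ 2 * n → F n m k ≡ F n k m ⊕ w n (m ∸ k)
      above        : ∀ m k → 1 ≤ m → suc (suc m) ≤ k → k ≤ 2 * n →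
                     F n (suc m) k ⊕ F n m (k ∸ 1) ≡ twice (F n m k) ⊕ w n (k ∸ m)
      rowSum-sym   : ∀ a b → a + b ≡ suc (suc (2 * n)) → r n a ≡ r n b
      colSum-shift : ∀ k → 1 ≤ k → k ≤ 2 * n → c n k ≡ r n (suc k)
      rowSum-Δ²    : ∀ d → 1 ≤ d → suc d ≤ 2 * n → Δ² (r n) d ≡ ⊝ twice (w n d)

  module LevelStep (N : ℕ) (1≤N : 1 ≤ N) (I : Invariant N) where
    open Invariant I

    n : ℕ
    n = suc N

    1≤n : 1 ≤ n
    1≤n = s≤s z≤n

    2≤n : 2 ≤ n
    2≤n = s≤s 1≤N

    2n≡ : 2 * n ≡ suc (suc (2 * N))
    2n≡ = double-suc N

    2n∸2≡ : 2 * n ∸ 2 ≡ 2 * N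
    2n∸2≡ = cong (_∸ 2) 2n≡

    2n∸1≡ : 2 * n ∸ 1 ≡ suc (2 * N)
    2n∸1≡ = cong (_∸ 1) 2n≡

    Δ²-column : ∀ m k → 1 ≤ k → k < m → m ≤ 2 * N → Δ² (λ i → F n i k) m ≡ ⊝ twice (F N m k)
    Δ²-column m k 1≤k k<m m≤2N =
      recurrence-Δ² {f n m k} {f n (suc m) k} {f n (suc (suc m)) k} {f N m k}
      (subst₂ (λ p q → f n p k + f n m k + 2 * f N m k ≡ 2 * f n q k) (ℕP.+-comm m 2) (ℕP.+-comm m 1)
        (recL n m k 2≤n (subst (2 ≤_) (ℕP.+-comm 1 k) (s≤s 1≤k)) (subst (_≤ m) (ℕP.+-comm 1 k) k<m)
              (subst (m ≤_) (sym 2n∸2≡) m≤2N)))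

    Δ²-row : ∀ m k → 1 ≤ m → m < k → k ≤ 2 * N → Δ² (F n m) k ≡ ⊝ twice (F N m k)
    Δ²-row m k 1≤m m<k k≤2N =
      recurrence-Δ² {f n m k} {f n m (suc k)} {f n m (suc (suc k))} {f N m k}
      (subst₂ (λ p q → f n m p + f n m k + 2 * f N m k ≡ 2 * f n m q) (ℕP.+-comm k 2) (ℕP.+-comm k 1)
        (recU n m k 2≤n (subst (2 ≤_) (ℕP.+-comm 1 m) (s≤s 1≤m)) (subst (_≤ k) (ℕP.+-comm 1 m) m<k)
              (subst (k ≤_) (sym 2n∸2≡) k≤2N)))

    diagonal : ∀ m → F n m m ≡ 0ℤ
    diagonal m = cong +_ (diag n m 2≤n)

    lastCol-zero⁺ : ∀ m → F n m (2 * n) ≡ 0ℤ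
    lastCol-zero⁺ m = cong +_ (col2n n m 2≤n)

    lastCol : ∀ m → F n m (suc (suc (2 * N))) ≡ 0ℤ
    lastCol m = subst (λ t → F n m t ≡ 0ℤ) 2n≡ (lastCol-zero⁺ m)

    penultimateCol : ∀ m → m ≤ 2 * N → F n m (suc (2 * N)) ≡ r N m
    penultimateCol m m≤2N = begin
      F n m (suc (2 * N))   ≡⟨ cong (F n m) (sym 2n∸1≡) ⟩
      F n m (2 * n ∸ 1)     ≡⟨ cong +_ (col2n-1 n m 2≤n (subst (m ≤_) (sym 2n∸2≡) m≤2N)) ⟩
      + rowSum f N m        ≡⟨ rowSum-cast N m ⟩
      r N m                 ∎
      where open ≡-Reasoning

    penultimateRow : ∀ k → k ≤ 2 * N → F n (suc (2 * N)) k ≡ r N k ⊕ c N k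
    penultimateRow k k≤2N = begin
      F n (suc (2 * N)) k                 ≡⟨ cong (λ t → F n t k) (sym 2n∸1≡) ⟩
      F n (2 * n ∸ 1) k                   ≡⟨ cong +_ (row2n-1 n k 2≤n (subst (k ≤_) (sym 2n∸2≡) k≤2N)) ⟩
      + (rowSum f N k + colSum f N k)     ≡⟨ cong₂ _⊕_ (rowSum-cast N k) (colSum-cast N k) ⟩
      r N k ⊕ c N k                       ∎
      where open ≡-Reasoning

    lastRow-tail : ∀ d → 2 * N < d → w n d ≡ 0ℤ
    lastRow-tail d 2N<d with ℕP.m≤n⇒m<n∨m≡n 2N<d
    ... | inj₂ refl = trans (cong (F n (2 * n)) (sym 2n∸1≡)) (cong +_ (row2n-last1 n 2≤n))
    ... | inj₁ 2N+1<d with ℕP.m≤n⇒m<n∨m≡n 2N+1<d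
    ...   | inj₂ refl   = trans (cong (F n (2 * n)) (sym 2n≡)) (cong +_ (row2n-last2 n 2≤n))
    ...   | inj₁ 2N+2<d = F-colBeyond (2 * n) 1≤n (subst (_< d) (sym 2n≡) 2N+2<d)

    lastRow : ∀ d → w n d ≡ r N d
    lastRow d with ℕP.≤-<-connex d (2 * N)
    ... | inj₁ d≤2N = trans (cong +_ (row2n n d 2≤n (subst (d ≤_) (sym 2n∸2≡) d≤2N))) (rowSum-cast N d)
    ... | inj₂ 2N<d = trans (lastRow-tail d 2N<d) (sym (r-beyond 1≤N 2N<d))

    lastRow′ : ∀ k → F n (suc (suc (2 * N))) k ≡ r N k
    lastRow′ k = subst (λ t → F n t k ≡ r N k) 2n≡ (lastRow k)

    r-row1 : r N 1 ≡ 0ℤ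
    r-row1 = sumℤ-zero (2 * N) (λ k _ _ → row1-zero k)

    lastRow-1 : w n 1 ≡ 0ℤ
    lastRow-1 = trans (lastRow 1) r-row1

    lastRow-sym : ∀ a b → a + b ≡ 2 * n → w n a ≡ w n b
    lastRow-sym a b a+b≡2n = begin
      w n a   ≡⟨ lastRow a ⟩
      r N a   ≡⟨ rowSum-sym a b (trans a+b≡2n 2n≡) ⟩
      r N b   ≡⟨ sym (lastRow b) ⟩
      w n b   ∎
      where open ≡-Reasoning

    -- Row 1 of M_n vanishes: by (c) it has zero second difference (row 1 of M_N
    -- vanishes) and it ends with r N 1 = 0 and 0 in columns 2n−1, 2n.
    row1-zero⁺ : ∀ k → F n 1 k ≡ 0ℤ
    row1-zero⁺ zero          = F-col0 1 1≤n
    row1-zero⁺ (suc zero)    = diagonal 1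
    row1-zero⁺ k@(suc (suc _)) with ℕP.≤-<-connex k (suc (suc (2 * N)))
    ... | inj₁ k≤2n = Δ²-backward-zero (F n 1) 2 (suc (2 * N))
                        (λ _ → trans (penultimateCol 1 (ℕP.≤-trans 1≤N (ℕP.m≤m+n N _))) r-row1)
                        (lastCol 1) harmonic k (s≤s (s≤s z≤n)) k≤2n
      where
      harmonic : ∀ i → 2 ≤ i → i < suc (2 * N) → Δ² (F n 1) i ≡ 0ℤ
      harmonic i 2≤i (s≤s i≤2N) = trans (Δ²-row 1 i (s≤s z≤n) 2≤i i≤2N) (cong (⊝_ ∘ twice) (row1-zero i))
    ... | inj₂ 2n<k = F-colBeyond 1 1≤n (subst (_< k) (sym 2n≡) 2n<k)

    -- For fixed k the defect
    --   X i = f_n(i,k) − f_n(k,i) − r_N(i−k)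
    -- has zero second difference for k < i ≤ 2N (by (b), (c), 'below' and
    -- 'rowSum-Δ²' at level N) and vanishes at i = 2n−1, 2n (by (d), (e) and the
    -- row sum identities at level N), so it vanishes on (k, 2n].
    below⁺ : ∀ m k → 1 ≤ k → k < m → m ≤ 2 * n → F n m k ≡ F n k m ⊕ w n (m ∸ k)
    below⁺ m k 1≤k k<m m≤2n =
      trans (difference-zero {b = F n k m} {c = r N (m ∸ k)} (X-zero m k<m (subst (m ≤_) 2n≡ m≤2n)))
            (cong (F n k m ⊕_) (sym (lastRow (m ∸ k))))
      where
      open ≡-Reasoning
      T : ℕ
      T = suc (suc (2 * N))

      X : ℕ → ℤ
      X i = (F n i k ⊖ F n k i) ⊖ r N (i ∸ k)

      X-top : X T ≡ 0ℤ
      X-top = begin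
        (F n T k ⊖ F n k T) ⊖ r N (T ∸ k)   ≡⟨ cong₂ (λ a b → (a ⊖ b) ⊖ r N (T ∸ k)) (lastRow′ k) (lastCol k) ⟩
        (r N k ⊖ 0ℤ) ⊖ r N (T ∸ k)          ≡⟨ cong ((r N k ⊖ 0ℤ) ⊖_) (sym (rowSum-sym k (T ∸ k) complementary)) ⟩
        (r N k ⊖ 0ℤ) ⊖ r N k                ≡⟨ cancel (r N k) ⟩
        0ℤ                                  ∎
        where
        complementary : k + (T ∸ k) ≡ T
        complementary = ℕP.m+[n∸m]≡n (ℕP.≤-trans (ℕP.<⇒≤ k<m) (subst (m ≤_) 2n≡ m≤2n))
        cancel : ∀ a → (a ⊖ 0ℤ) ⊖ a ≡ 0ℤ
        cancel = solve-∀

      X-penultimate : suc k ≤ suc (2 * N) → X (suc (2 * N)) ≡ 0ℤ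
      X-penultimate (s≤s k≤2N) = begin
        (F n (suc (2 * N)) k ⊖ F n k (suc (2 * N))) ⊖ r N (suc (2 * N) ∸ k)
          ≡⟨ cong₂ (λ a b → (a ⊖ b) ⊖ r N (suc (2 * N) ∸ k)) (penultimateRow k k≤2N) (penultimateCol k k≤2N) ⟩
        ((r N k ⊕ c N k) ⊖ r N k) ⊖ r N (suc (2 * N) ∸ k)
          ≡⟨ cong (λ a → ((r N k ⊕ a) ⊖ r N k) ⊖ r N (suc (2 * N) ∸ k)) (colSum-shift k 1≤k k≤2N) ⟩
        ((r N k ⊕ r N (suc k)) ⊖ r N k) ⊖ r N (suc (2 * N) ∸ k)
          ≡⟨ cong (((r N k ⊕ r N (suc k)) ⊖ r N k) ⊖_) (sym (rowSum-sym (suc k) (suc (2 * N) ∸ k) reflected)) ⟩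
        ((r N k ⊕ r N (suc k)) ⊖ r N k) ⊖ r N (suc k)
          ≡⟨ cancel (r N k) (r N (suc k)) ⟩
        0ℤ ∎
        where
        reflected : suc k + (suc (2 * N) ∸ k) ≡ T
        reflected = cong suc (ℕP.m+[n∸m]≡n (ℕP.m≤n⇒m≤1+n k≤2N))
        cancel : ∀ a b → ((a ⊕ b) ⊖ a) ⊖ b ≡ 0ℤ
        cancel = solve-∀

      harmonic : ∀ i → suc k ≤ i → i < suc (2 * N) → Δ² X i ≡ 0ℤ
      harmonic i k<i (s≤s i≤2N) = begin
        Δ² X i
          ≡⟨ Δ²-⊖ (λ i → F n i k ⊖ F n k i) (λ i → r N (i ∸ k)) i ⟩
        Δ² (λ i → F n i k ⊖ F n k i) i ⊖ Δ² (λ i → r N (i ∸ k)) i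
          ≡⟨ cong₂ _⊖_ (Δ²-⊖ (λ i → F n i k) (F n k) i) (Δ²-shift (r N) (ℕP.<⇒≤ k<i)) ⟩
        (Δ² (λ i → F n i k) i ⊖ Δ² (F n k) i) ⊖ Δ² (r N) (i ∸ k)
          ≡⟨ cong₂ _⊖_ (cong₂ _⊖_ (Δ²-column i k 1≤k k<i i≤2N) (Δ²-row k i 1≤k k<i i≤2N))
                       (rowSum-Δ² (i ∸ k) (1≤∸ k<i) (ℕP.≤-trans (suc∸≤ 1≤k (ℕP.<⇒≤ k<i)) i≤2N)) ⟩
        (⊝ twice (F N i k) ⊖ ⊝ twice (F N k i)) ⊖ ⊝ twice (w N (i ∸ k))
          ≡⟨ factor (F N i k) (F N k i) (w N (i ∸ k)) ⟩
        ⊝ twice (F N i k ⊖ (F N k i ⊕ w N (i ∸ k)))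
          ≡⟨ scaled-zero (below i k 1≤k k<i i≤2N) ⟩
        0ℤ ∎
        where
        factor : ∀ a b c → (⊝ (a ⊕ a) ⊖ ⊝ (b ⊕ b)) ⊖ ⊝ (c ⊕ c) ≡ ⊝ ((a ⊖ (b ⊕ c)) ⊕ (a ⊖ (b ⊕ c)))
        factor = solve-∀

      X-zero : ∀ i → suc k ≤ i → i ≤ T → X i ≡ 0ℤ
      X-zero = Δ²-backward-zero X (suc k) (suc (2 * N)) X-penultimate X-top harmonic

    -- For fixed m the defect
    --   Y i = f_n(m+1,i) + f_n(m,i−1) − 2 f_n(m,i) − r_N(i−m)
    -- has zero second difference for m+2 ≤ i ≤ 2N (by (c), 'above' and
    -- 'rowSum-Δ²' at level N) and vanishes at i = 2n−1, 2n, so it vanishes on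
    -- [m+2, 2n].
    above⁺ : ∀ m k → 1 ≤ m → suc (suc m) ≤ k → k ≤ 2 * n →
             F n (suc m) k ⊕ F n m (k ∸ 1) ≡ twice (F n m k) ⊕ w n (k ∸ m)
    above⁺ m k 1≤m m+2≤k k≤2n =
      trans (difference-zero {b = twice (F n m k)} {c = r N (k ∸ m)} (Y-zero k m+2≤k k≤T))
            (cong (twice (F n m k) ⊕_) (sym (lastRow (k ∸ m))))
      where
      open ≡-Reasoning
      T : ℕ
      T = suc (suc (2 * N))

      k≤T : k ≤ T
      k≤T = subst (k ≤_) 2n≡ k≤2n

      m≤2N : m ≤ 2 * N
      m≤2N = ℕP.≤-pred (ℕP.≤-pred (ℕP.≤-trans m+2≤k k≤T))

      Y : ℕ → ℤ
      Y i = ((F n (suc m) i ⊕ F n m (i ∸ 1)) ⊖ twice (F n m i)) ⊖ r N (i ∸ m)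

      Y-top : Y T ≡ 0ℤ
      Y-top = begin
        ((F n (suc m) T ⊕ F n m (suc (2 * N))) ⊖ twice (F n m T)) ⊖ r N (T ∸ m)
          ≡⟨ cong₂ (λ a b → ((a ⊕ b) ⊖ twice (F n m T)) ⊖ r N (T ∸ m)) (lastCol (suc m)) (penultimateCol m m≤2N) ⟩
        ((0ℤ ⊕ r N m) ⊖ twice (F n m T)) ⊖ r N (T ∸ m)
          ≡⟨ cong₂ (λ a b → ((0ℤ ⊕ r N m) ⊖ twice a) ⊖ b) (lastCol m)
                   (sym (rowSum-sym m (T ∸ m) (ℕP.m+[n∸m]≡n (ℕP.≤-trans m≤2N (ℕP.m≤n+m _ 2))))) ⟩
        ((0ℤ ⊕ r N m) ⊖ twice 0ℤ) ⊖ r N m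
          ≡⟨ cancel (r N m) ⟩
        0ℤ ∎
        where
        cancel : ∀ a → ((0ℤ ⊕ a) ⊖ (0ℤ ⊕ 0ℤ)) ⊖ a ≡ 0ℤ
        cancel = solve-∀

      -- uses (c) at the end of row m: f_n(m,2n−2) = 2 f_n(m,2n−1) = 2 r_N(m)
      Y-penultimate : suc (suc m) ≤ suc (2 * N) → Y (suc (2 * N)) ≡ 0ℤ
      Y-penultimate (s≤s m<2N) = begin
        ((F n (suc m) (suc (2 * N)) ⊕ F n m (2 * N)) ⊖ twice (F n m (suc (2 * N)))) ⊖ r N (suc (2 * N) ∸ m)
          ≡⟨ cong₂ (λ a b → ((a ⊕ F n m (2 * N)) ⊖ twice b) ⊖ r N (suc (2 * N) ∸ m))
                   (penultimateCol (suc m) m<2N) (penultimateCol m m≤2N) ⟩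
        ((r N (suc m) ⊕ F n m (2 * N)) ⊖ twice (r N m)) ⊖ r N (suc (2 * N) ∸ m)
          ≡⟨ cong (((r N (suc m) ⊕ F n m (2 * N)) ⊖ twice (r N m)) ⊖_)
                  (sym (rowSum-sym (suc m) (suc (2 * N) ∸ m) (cong suc (ℕP.m+[n∸m]≡n (ℕP.m≤n⇒m≤1+n m≤2N))))) ⟩
        ((r N (suc m) ⊕ F n m (2 * N)) ⊖ twice (r N m)) ⊖ r N (suc m)
          ≡⟨ drop (r N (suc m)) (F n m (2 * N)) (r N m) ⟩
        (F n m (2 * N) ⊕ 0ℤ) ⊖ twice (r N m)
          ≡⟨ cong₂ (λ a b → (F n m (2 * N) ⊕ a) ⊖ twice b) (sym (lastCol m)) (sym (penultimateCol m m≤2N)) ⟩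
        Δ² (F n m) (2 * N)
          ≡⟨ Δ²-row m (2 * N) 1≤m m<2N ℕP.≤-refl ⟩
        ⊝ twice (F N m (2 * N))
          ≡⟨ cong (⊝_ ∘ twice) (lastCol-zero m) ⟩
        0ℤ ∎
        where
        drop : ∀ b x a → ((b ⊕ x) ⊖ (a ⊕ a)) ⊖ b ≡ (x ⊕ 0ℤ) ⊖ (a ⊕ a)
        drop = solve-∀

      harmonic : ∀ i → suc (suc m) ≤ i → i < suc (2 * N) → Δ² Y i ≡ 0ℤ
      harmonic (suc i) (s≤s m<i) (s≤s i+1≤2N) = begin
        Δ² Y (suc i)
          ≡⟨ Δ²-⊖ (λ i → (F n (suc m) i ⊕ F n m (i ∸ 1)) ⊖ twice (F n m i)) (λ i → r N (i ∸ m)) (suc i) ⟩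
        Δ² (λ i → (F n (suc m) i ⊕ F n m (i ∸ 1)) ⊖ twice (F n m i)) (suc i) ⊖ Δ² (λ i → r N (i ∸ m)) (suc i)
          ≡⟨ cong₂ _⊖_ (Δ²-⊖ (λ i → F n (suc m) i ⊕ F n m (i ∸ 1)) (λ i → twice (F n m i)) (suc i))
                       (Δ²-shift (r N) m≤i+1) ⟩
        (Δ² (λ i → F n (suc m) i ⊕ F n m (i ∸ 1)) (suc i) ⊖ Δ² (λ i → twice (F n m i)) (suc i)) ⊖ Δ² (r N) d
          ≡⟨ cong (_⊖ Δ² (r N) d) (cong₂ _⊖_ (Δ²-⊕ (F n (suc m)) (λ i → F n m (i ∸ 1)) (suc i))
                                             (Δ²-twice (F n m) (suc i))) ⟩
        ((Δ² (F n (suc m)) (suc i) ⊕ Δ² (λ i → F n m (i ∸ 1)) (suc i)) ⊖ twice (Δ² (F n m) (suc i))) ⊖ Δ² (r N) d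
          ≡⟨ cong (λ t → ((Δ² (F n (suc m)) (suc i) ⊕ t) ⊖ twice (Δ² (F n m) (suc i))) ⊖ Δ² (r N) d)
                  (Δ²-shift (F n m) (s≤s z≤n)) ⟩
        ((Δ² (F n (suc m)) (suc i) ⊕ Δ² (F n m) i) ⊖ twice (Δ² (F n m) (suc i))) ⊖ Δ² (r N) d
          ≡⟨ cong₂ _⊖_ (cong₂ _⊖_ (cong₂ _⊕_ (Δ²-row (suc m) (suc i) (s≤s z≤n) (s≤s m<i) i+1≤2N)
                                             (Δ²-row m i 1≤m m<i (ℕP.≤-trans (ℕP.n≤1+n i) i+1≤2N)))
                                  (cong twice (Δ²-row m (suc i) 1≤m m<i+1 i+1≤2N)))
                       (rowSum-Δ² d (1≤∸ m<i+1) (ℕP.≤-trans (suc∸≤ 1≤m m≤i+1) i+1≤2N)) ⟩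
        ((⊝ twice (F N (suc m) (suc i)) ⊕ ⊝ twice (F N m i)) ⊖ twice (⊝ twice (F N m (suc i)))) ⊖ ⊝ twice (w N d)
          ≡⟨ factor (F N (suc m) (suc i)) (F N m i) (F N m (suc i)) (w N d) ⟩
        ⊝ twice ((F N (suc m) (suc i) ⊕ F N m i) ⊖ (twice (F N m (suc i)) ⊕ w N d))
          ≡⟨ scaled-zero (above m (suc i) 1≤m (s≤s m<i) i+1≤2N) ⟩
        0ℤ ∎
        where
        d : ℕ
        d = suc i ∸ m
        m<i+1 : m < suc i
        m<i+1 = ℕP.≤-trans (ℕP.n≤1+n (suc m)) (s≤s m<i)
        m≤i+1 : m ≤ suc i
        m≤i+1 = ℕP.<⇒≤ m<i+1
        factor : ∀ a b c e →
          ((⊝ (a ⊕ a) ⊕ ⊝ (b ⊕ b)) ⊖ (⊝ (c ⊕ c) ⊕ ⊝ (c ⊕ c))) ⊖ ⊝ (e ⊕ e) ≡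
          ⊝ (((a ⊕ b) ⊖ ((c ⊕ c) ⊕ e)) ⊕ ((a ⊕ b) ⊖ ((c ⊕ c) ⊕ e)))
        factor = solve-∀

      Y-zero : ∀ i → suc (suc m) ≤ i → i ≤ T → Y i ≡ 0ℤ
      Y-zero = Δ²-backward-zero Y (suc (suc m)) (suc (2 * N)) Y-penultimate Y-top harmonic

  -- The row and column sum identities at a level n, derived from the entry
  -- identities at the same level and from two properties of the last row,
  -- w_n(1) = 0 and w_n(a) = w_n(2n − a), which are inherited from level n − 1.
  module RowSums (n : ℕ) (1≤n : 1 ≤ n)
      (row1-zero    : ∀ k → F n 1 k ≡ 0ℤ)
      (lastCol-zero : ∀ m → F n m (2 * n) ≡ 0ℤ)
      (diagonal     : ∀ m → F n m m ≡ 0ℤ)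
      (below        : ∀ m k → 1 ≤ k → k < m → m ≤ 2 * n → F n m k ≡ F n k m ⊕ w n (m ∸ k))
      (above        : ∀ m k → 1 ≤ m → suc (suc m) ≤ k → k ≤ 2 * n →
                      F n (suc m) k ⊕ F n m (k ∸ 1) ≡ twice (F n m k) ⊕ w n (k ∸ m))
      (lastRow-1    : w n 1 ≡ 0ℤ)
      (lastRow-sym  : ∀ a b → a + b ≡ 2 * n → w n a ≡ w n b) where

    lastRow-0 : w n 0 ≡ 0ℤ
    lastRow-0 = F-col0 (2 * n) 1≤n

    lastRow-beyond : w n (suc (2 * n)) ≡ 0ℤ
    lastRow-beyond = F-colBeyond (2 * n) 1≤n ℕP.≤-refl

    lastRow-trunc : ∀ {i j} → i ≤ j → w n (i ∸ j) ≡ 0ℤ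
    lastRow-trunc i≤j = trans (cong (w n) (ℕP.m≤n⇒m∸n≡0 i≤j)) lastRow-0

    -- By 'below', f_n(m,k) − f_n(k,m) depends only on the last row:
    skew : ℕ → ℕ → ℤ
    skew k m = w n (m ∸ k) ⊖ w n (k ∸ m)

    skewSum : ℕ → ℤ
    skewSum k = sumℤ (2 * n) (skew k)

    antisymmetry : ∀ k → 1 ≤ k → k ≤ 2 * n → ∀ m → 1 ≤ m → m ≤ 2 * n → F n m k ⊖ F n k m ≡ skew k m
    antisymmetry k 1≤k k≤2n m 1≤m m≤2n with ℕP.<-cmp m k
    ... | tri< m<k _ _ =
      flipped (F n m k) (w n (k ∸ m)) (below k m 1≤m m<k k≤2n) (lastRow-trunc (ℕP.<⇒≤ m<k))
      where
      flipped : ∀ a u {b z} → b ≡ a ⊕ u → z ≡ 0ℤ → a ⊖ b ≡ z ⊖ u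
      flipped a u refl refl = negate a u
        where
        negate : ∀ a u → a ⊖ (a ⊕ u) ≡ 0ℤ ⊖ u
        negate = solve-∀
    ... | tri≈ _ refl _ = trans (ℤP.+-inverseʳ (F n m m)) (sym (ℤP.+-inverseʳ (w n (m ∸ m))))
    ... | tri> _ _ k<m =
      direct (F n k m) (w n (m ∸ k)) (below m k 1≤k k<m m≤2n) (lastRow-trunc (ℕP.<⇒≤ k<m))
      where
      direct : ∀ a u {b z} → b ≡ a ⊕ u → z ≡ 0ℤ → b ⊖ a ≡ u ⊖ z
      direct a u refl refl = cancel a u
        where
        cancel : ∀ a u → (a ⊕ u) ⊖ a ≡ u ⊖ 0ℤ
        cancel = solve-∀

    colSum-rowSum : ∀ k → 1 ≤ k → k ≤ 2 * n → c n k ≡ r n k ⊕ skewSum k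
    colSum-rowSum k 1≤k k≤2n = move-right (begin
      c n k ⊖ r n k                              ≡⟨ sym (sumℤ-⊖ (2 * n) (λ m → F n m k) (F n k)) ⟩
      sumℤ (2 * n) (λ m → F n m k ⊖ F n k m)     ≡⟨ sumℤ-cong (2 * n) (antisymmetry k 1≤k k≤2n) ⟩
      skewSum k                                  ∎)
      where open ≡-Reasoning

    -- The potential P_j(k) = f_n(k+1,j+1) (k < j), 2 f_n(j,j+1) (k = j),
    -- f_n(j,k) (k > j), whose increments are the row differences up to skew.
    -- It is used only through the three equations below, hence kept abstract.
    abstract
      potential : ℕ → ℕ → ℤ
      potential j k with ℕP.<-cmp k j
      ... | tri< _ _ _ = F n (suc k) (suc j)
      ... | tri≈ _ _ _ = twice (F n j (suc j))
      ... | tri> _ _ _ = F n j k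

      potential-< : ∀ {j k} → k < j → potential j k ≡ F n (suc k) (suc j)
      potential-< {j} {k} k<j with ℕP.<-cmp k j
      ... | tri< _ _ _    = refl
      ... | tri≈ k≮j _ _ = ⊥-elim (k≮j k<j)
      ... | tri> k≮j _ _ = ⊥-elim (k≮j k<j)

      potential-≡ : ∀ j → potential j j ≡ twice (F n j (suc j))
      potential-≡ j with ℕP.<-cmp j j
      ... | tri< _ j≢j _ = ⊥-elim (j≢j refl)
      ... | tri≈ _ _ _   = refl
      ... | tri> _ j≢j _ = ⊥-elim (j≢j refl)

      potential-> : ∀ {j k} → j < k → potential j k ≡ F n j k
      potential-> {j} {k} j<k with ℕP.<-cmp k j
      ... | tri< _ _ k≯j = ⊥-elim (k≯j j<k)
      ... | tri≈ _ _ k≯j = ⊥-elim (k≯j j<k)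
      ... | tri> _ _ _   = refl

    -- Row difference = increment of the potential + skew, by 'below' (k < j),
    -- 'above' (k > j+1) and the diagonal (k = j, j+1).
    row-difference : ∀ j → 1 ≤ j → j < 2 * n → ∀ k → 1 ≤ k → k ≤ 2 * n →
      F n (suc j) k ⊖ F n j k ≡ (potential j k ⊖ potential j (k ∸ 1)) ⊕ skew j k
    row-difference j 1≤j j<2n (suc k) _ k+1≤2n with ℕP.<-cmp (suc k) j
    ... | tri< k+1<j _ _ =
      below-case (F n (suc k) (suc j)) (F n (suc k) j) (F n (suc (suc k)) (suc j))
                 (w n (suc j ∸ suc k)) (w n (j ∸ suc k))
        (below (suc j) (suc k) (s≤s z≤n) (ℕP.m<n⇒m<1+n k+1<j) j<2n)
        (below j (suc k) (s≤s z≤n) k+1<j (ℕP.<⇒≤ j<2n))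
        (potential-< k+1<j) (potential-< (ℕP.<-trans (ℕP.n<1+n k) k+1<j))
        (lastRow-trunc (ℕP.<⇒≤ k+1<j))
        (above (suc k) (suc j) (s≤s z≤n) (s≤s k+1<j) j<2n)
      where
      below-case : ∀ C E G u v {A B P P′ z} → A ≡ C ⊕ u → B ≡ E ⊕ v → P ≡ G → P′ ≡ C → z ≡ 0ℤ →
        G ⊕ E ≡ twice C ⊕ u → A ⊖ B ≡ (P ⊖ P′) ⊕ (z ⊖ v)
      below-case C E G u v refl refl refl refl refl laplace = from-difference (key C E G u v) (sym laplace)
        where
        key : ∀ C E G u v → ((C ⊕ u) ⊖ (E ⊕ v)) ⊖ ((G ⊖ C) ⊕ (0ℤ ⊖ v)) ≡ ((C ⊕ C) ⊕ u) ⊖ (G ⊕ E)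
        key = solve-∀
    ... | tri≈ _ refl _ =
      diagonal-case (F n (suc k) (suc (suc k))) {z = w n (k ∸ k)}
        (below (suc (suc k)) (suc k) (s≤s z≤n) ℕP.≤-refl j<2n)
        (trans (cong (w n) (ℕP.m+n∸n≡m 1 k)) lastRow-1)
        (diagonal (suc k)) (potential-≡ (suc k)) (potential-< ℕP.≤-refl)
      where
      diagonal-case : ∀ C {A B P P′ u z} → A ≡ C ⊕ u → u ≡ 0ℤ → B ≡ 0ℤ → P ≡ twice C → P′ ≡ C →
        A ⊖ B ≡ (P ⊖ P′) ⊕ (z ⊖ z)
      diagonal-case C {z = z} refl refl refl refl refl = halve C z
        where
        halve : ∀ C z → (C ⊕ 0ℤ) ⊖ 0ℤ ≡ ((C ⊕ C) ⊖ C) ⊕ (z ⊖ z)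
        halve = solve-∀
    ... | tri> _ _ j<k+1 with ℕP.m≤n⇒m<n∨m≡n (ℕP.≤-pred j<k+1)
    ...   | inj₂ refl =
      diagonal-case (F n j (suc j))
        (diagonal (suc j)) refl (potential-> (ℕP.n<1+n j)) (potential-≡ j)
        (trans (cong (w n) (ℕP.m+n∸n≡m 1 j)) lastRow-1) (lastRow-trunc (ℕP.n≤1+n j))
      where
      diagonal-case : ∀ C {A B P P′ u v} → A ≡ 0ℤ → B ≡ C → P ≡ C → P′ ≡ twice C → u ≡ 0ℤ → v ≡ 0ℤ →
        A ⊖ B ≡ (P ⊖ P′) ⊕ (u ⊖ v)
      diagonal-case C refl refl refl refl refl refl = halve C
        where
        halve : ∀ C → 0ℤ ⊖ C ≡ (C ⊖ (C ⊕ C)) ⊕ (0ℤ ⊖ 0ℤ)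
        halve = solve-∀
    ...   | inj₁ j<k =
      above-case (F n (suc j) (suc k)) (F n j (suc k)) (F n j k) (w n (suc k ∸ j))
        (potential-> j<k+1) (potential-> j<k) (lastRow-trunc (ℕP.<⇒≤ j<k+1))
        (above j (suc k) 1≤j (s≤s j<k) k+1≤2n)
      where
      above-case : ∀ A B B′ u {P P′ z} → P ≡ B → P′ ≡ B′ → z ≡ 0ℤ → A ⊕ B′ ≡ twice B ⊕ u →
        A ⊖ B ≡ (P ⊖ P′) ⊕ (u ⊖ z)
      above-case A B B′ u refl refl refl laplace = from-difference (key A B B′ u) laplace
        where
        key : ∀ A B B′ u → (A ⊖ B) ⊖ ((B ⊖ B′) ⊕ (u ⊖ 0ℤ)) ≡ (A ⊕ B′) ⊖ ((B ⊕ B) ⊕ u)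
        key = solve-∀

    -- Summing the row differences: the potential telescopes to
    -- P_j(2n) − P_j(0) = f_n(j,2n) − f_n(1,j+1) = 0.
    rowSum-step : ∀ j → 1 ≤ j → j < 2 * n → r n (suc j) ≡ r n j ⊕ skewSum j
    rowSum-step j 1≤j j<2n = move-right (begin
      r n (suc j) ⊖ r n j
        ≡⟨ sym (sumℤ-⊖ (2 * n) (F n (suc j)) (F n j)) ⟩
      sumℤ (2 * n) (λ k → F n (suc j) k ⊖ F n j k)
        ≡⟨ sumℤ-cong (2 * n) (row-difference j 1≤j j<2n) ⟩
      sumℤ (2 * n) (λ k → (P k ⊖ P (k ∸ 1)) ⊕ skew j k)
        ≡⟨ sumℤ-⊕ (2 * n) (λ k → P k ⊖ P (k ∸ 1)) (skew j) ⟩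
      sumℤ (2 * n) (λ k → P k ⊖ P (k ∸ 1)) ⊕ skewSum j
        ≡⟨ cong (_⊕ skewSum j) (sumℤ-telescope (2 * n) P) ⟩
      (P (2 * n) ⊖ P 0) ⊕ skewSum j
        ≡⟨ cong₂ (λ a b → (a ⊖ b) ⊕ skewSum j)
                 (trans (potential-> j<2n) (lastCol-zero j)) (trans (potential-< 1≤j) (row1-zero (suc j))) ⟩
      (0ℤ ⊖ 0ℤ) ⊕ skewSum j
        ≡⟨ ℤP.+-identityˡ (skewSum j) ⟩
      skewSum j ∎)
      where
      open ≡-Reasoning
      P : ℕ → ℤ
      P = potential j

    colSum-shift : ∀ k → 1 ≤ k → k ≤ 2 * n → c n k ≡ r n (suc k)
    colSum-shift k 1≤k k≤2n with ℕP.m≤n⇒m<n∨m≡n k≤2n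
    ... | inj₁ k<2n = trans (colSum-rowSum k 1≤k k≤2n) (sym (rowSum-step k 1≤k k<2n))
    ... | inj₂ refl = trans (sumℤ-zero (2 * n) (λ m _ _ → lastCol-zero m)) (sym (r-beyond 1≤n ℕP.≤-refl))

    skewSum-step : ∀ d → d ≤ 2 * n → skewSum (suc d) ⊖ skewSum d ≡ ⊝ twice (w n d)
    skewSum-step d d≤2n = begin
      skewSum (suc d) ⊖ skewSum d
        ≡⟨ sym (sumℤ-⊖ (2 * n) (skew (suc d)) (skew d)) ⟩
      sumℤ (2 * n) (λ k → skew (suc d) k ⊖ skew d k)
        ≡⟨ sumℤ-cong (2 * n) pointwise ⟩
      sumℤ (2 * n) (λ k → (L k ⊖ L (k ∸ 1)) ⊖ (R k ⊖ R (k ∸ 1)))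
        ≡⟨ sumℤ-⊖ (2 * n) (λ k → L k ⊖ L (k ∸ 1)) (λ k → R k ⊖ R (k ∸ 1)) ⟩
      sumℤ (2 * n) (λ k → L k ⊖ L (k ∸ 1)) ⊖ sumℤ (2 * n) (λ k → R k ⊖ R (k ∸ 1))
        ≡⟨ cong₂ _⊖_ (sumℤ-telescope (2 * n) L) (sumℤ-telescope (2 * n) R) ⟩
      (w n (d ∸ 2 * n) ⊖ w n d) ⊖ (w n (2 * n ∸ d) ⊖ w n (0 ∸ d))
        ≡⟨ cong₂ (λ a b → (a ⊖ w n d) ⊖ b) (lastRow-trunc d≤2n)
                 (cong₂ _⊖_ (sym (lastRow-sym d (2 * n ∸ d) (ℕP.m+[n∸m]≡n d≤2n))) (lastRow-trunc (z≤n {d}))) ⟩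
      (0ℤ ⊖ w n d) ⊖ (w n d ⊖ 0ℤ)
        ≡⟨ collect (w n d) ⟩
      ⊝ twice (w n d) ∎
      where
      open ≡-Reasoning
      L R : ℕ → ℤ
      L k = w n (d ∸ k)
      R k = w n (k ∸ d)
      pointwise : ∀ k → 1 ≤ k → k ≤ 2 * n → skew (suc d) k ⊖ skew d k ≡ (L k ⊖ L (k ∸ 1)) ⊖ (R k ⊖ R (k ∸ 1))
      pointwise (suc k) _ _ = regroup (w n (k ∸ d)) (w n (d ∸ k)) (w n (suc k ∸ d)) (w n (d ∸ suc k))
        where
        regroup : ∀ a b c e → (a ⊖ b) ⊖ (c ⊖ e) ≡ (e ⊖ b) ⊖ (c ⊖ a)
        regroup = solve-∀
      collect : ∀ a → (0ℤ ⊖ a) ⊖ (a ⊖ 0ℤ) ≡ ⊝ (a ⊕ a)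
      collect = solve-∀

    -- The last skew sum: skewSum(2n−1) = −r_n(2n), since skew(2n−1, k) = −w_n(k+1).
    skewSum-last : ∀ d → suc d ≡ 2 * n → skewSum d ≡ ⊝ r n (2 * n)
    skewSum-last d d+1≡2n = begin
      skewSum d                                 ≡⟨ sumℤ-cong (2 * n) pointwise ⟩
      sumℤ (2 * n) (λ k → 0ℤ ⊖ w n (suc k))     ≡⟨ sumℤ-⊖ (2 * n) (λ _ → 0ℤ) (λ k → w n (suc k)) ⟩
      sumℤ (2 * n) (λ _ → 0ℤ) ⊖ sumℤ (2 * n) (λ k → w n (suc k))
        ≡⟨ cong₂ _⊖_ (sumℤ-zero (2 * n) (λ _ _ _ → refl)) shifted-sum ⟩
      0ℤ ⊖ r n (2 * n)                          ≡⟨ ℤP.+-identityˡ (⊝ r n (2 * n)) ⟩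
      ⊝ r n (2 * n)                             ∎
      where
      open ≡-Reasoning
      pointwise : ∀ k → 1 ≤ k → k ≤ 2 * n → skew d k ≡ 0ℤ ⊖ w n (suc k)
      pointwise k _ k≤2n with ℕP.≤-<-connex k d
      ... | inj₁ k≤d = cong₂ _⊖_ (lastRow-trunc k≤d) (lastRow-sym (d ∸ k) (suc k) complementary)
        where
        complementary : d ∸ k + suc k ≡ 2 * n
        complementary = trans (ℕP.+-suc (d ∸ k) k) (trans (cong suc (ℕP.m∸n+n≡m k≤d)) d+1≡2n)
      ... | inj₂ d<k with ℕP.≤-antisym (subst (k ≤_) (sym d+1≡2n) k≤2n) d<k
      ...   | refl = cong₂ _⊖_ (trans (cong (w n) (ℕP.m+n∸n≡m 1 d)) lastRow-1)
                               (trans (lastRow-trunc (ℕP.n≤1+n d)) (sym w-2n+1))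
        where
        w-2n+1 : w n (suc (suc d)) ≡ 0ℤ
        w-2n+1 = trans (cong (w n ∘ suc) d+1≡2n) lastRow-beyond
      -- Σ_{k=1}^{2n} w_n(k+1) = Σ_{k=1}^{2n} w_n(k) + w_n(2n+1) − w_n(1)
      shifted-sum : sumℤ (2 * n) (λ k → w n (suc k)) ≡ r n (2 * n)
      shifted-sum = trans (move-right (begin
        sumℤ (2 * n) (λ k → w n (suc k)) ⊖ r n (2 * n)
          ≡⟨ sym (sumℤ-⊖ (2 * n) (λ k → w n (suc k)) (w n)) ⟩
        sumℤ (2 * n) (λ k → w n (suc k) ⊖ w n k)
          ≡⟨ sumℤ-cong (2 * n) (λ { (suc k) _ _ → refl }) ⟩
        sumℤ (2 * n) (λ k → w n (suc k) ⊖ w n (suc (k ∸ 1)))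
          ≡⟨ sumℤ-telescope (2 * n) (λ k → w n (suc k)) ⟩
        w n (suc (2 * n)) ⊖ w n 1
          ≡⟨ cong₂ _⊖_ lastRow-beyond lastRow-1 ⟩
        0ℤ ∎)) (ℤP.+-identityʳ (r n (2 * n)))

    rowSum-Δ² : ∀ d → 1 ≤ d → suc d ≤ 2 * n → Δ² (r n) d ≡ ⊝ twice (w n d)
    rowSum-Δ² d 1≤d d<2n with ℕP.m≤n⇒m<n∨m≡n d<2n
    ... | inj₁ d+1<2n = begin
      (r n d ⊕ r n (suc (suc d))) ⊖ twice (r n (suc d))
        ≡⟨ cong (λ t → (r n d ⊕ t) ⊖ twice (r n (suc d))) (rowSum-step (suc d) (s≤s z≤n) d+1<2n) ⟩
      (r n d ⊕ (r n (suc d) ⊕ skewSum (suc d))) ⊖ twice (r n (suc d))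
        ≡⟨ cong (λ t → (r n d ⊕ (t ⊕ skewSum (suc d))) ⊖ twice t) (rowSum-step d 1≤d d<2n) ⟩
      (r n d ⊕ ((r n d ⊕ skewSum d) ⊕ skewSum (suc d))) ⊖ twice (r n d ⊕ skewSum d)
        ≡⟨ difference (r n d) (skewSum d) (skewSum (suc d)) ⟩
      skewSum (suc d) ⊖ skewSum d
        ≡⟨ skewSum-step d (ℕP.<⇒≤ d<2n) ⟩
      ⊝ twice (w n d) ∎
      where
      open ≡-Reasoning
      difference : ∀ a q q′ → (a ⊕ ((a ⊕ q) ⊕ q′)) ⊖ ((a ⊕ q) ⊕ (a ⊕ q)) ≡ q′ ⊖ q
      difference = solve-∀
    ... | inj₂ d+1≡2n = begin
      (r n d ⊕ r n (suc (suc d))) ⊖ twice (r n (suc d))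
        ≡⟨ cong (λ t → (r n d ⊕ t) ⊖ twice (r n (suc d))) (r-beyond 1≤n (subst (_< suc (suc d)) d+1≡2n ℕP.≤-refl)) ⟩
      (r n d ⊕ 0ℤ) ⊖ twice (r n (suc d))
        ≡⟨ cong (λ t → (t ⊕ 0ℤ) ⊖ twice (r n (suc d))) r-penultimate ⟩
      (twice (r n (suc d)) ⊕ 0ℤ) ⊖ twice (r n (suc d))
        ≡⟨ cancel (r n (suc d)) ⟩
      0ℤ
        ≡⟨ cong (⊝_ ∘ twice) (sym (trans (lastRow-sym d 1 (trans (ℕP.+-comm d 1) d+1≡2n)) lastRow-1)) ⟩
      ⊝ twice (w n d) ∎
      where
      open ≡-Reasoning
      -- r(2n) = r(2n−1) + skewSum(2n−1) = r(2n−1) − r(2n)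
      last-step : r n (suc d) ≡ r n d ⊕ ⊝ r n (suc d)
      last-step = trans (rowSum-step d 1≤d (subst (d <_) d+1≡2n ℕP.≤-refl))
                        (cong (r n d ⊕_) (trans (skewSum-last d d+1≡2n) (cong (⊝_ ∘ r n) (sym d+1≡2n))))
      r-penultimate : r n d ≡ twice (r n (suc d))
      r-penultimate = from-difference (key (r n d) (r n (suc d))) (sym last-step)
        where
        key : ∀ a b → a ⊖ (b ⊕ b) ≡ (a ⊕ ⊝ b) ⊖ b
        key = solve-∀
      cancel : ∀ a → ((a ⊕ a) ⊕ 0ℤ) ⊖ (a ⊕ a) ≡ 0ℤ
      cancel = solve-∀

    row2 : ∀ k → 1 ≤ k → k ≤ 2 * n → F n 2 k ≡ w n (k ∸ 1)
    row2 (suc zero) _ _ =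
      trans (below 2 1 (s≤s z≤n) (s≤s (s≤s z≤n)) (ℕP.*-monoʳ-≤ 2 1≤n))
            (trans (cong₂ _⊕_ (row1-zero 2) lastRow-1) (sym lastRow-0))
    row2 (suc (suc zero)) _ _ = trans (diagonal 2) (sym lastRow-1)
    row2 k@(suc (suc (suc _))) _ k≤2n =
      isolate (F n 2 k) (w n (k ∸ 1)) (row1-zero (k ∸ 1)) (row1-zero k)
              (above 1 k (s≤s z≤n) (s≤s (s≤s (s≤s z≤n))) k≤2n)
      where
      isolate : ∀ x u {a b} → a ≡ 0ℤ → b ≡ 0ℤ → x ⊕ a ≡ twice b ⊕ u → x ≡ u
      isolate x u refl refl eq = trans (sym (ℤP.+-identityʳ x)) (trans eq (ℤP.+-identityˡ u))

    -- Hence r_n(2) = Σ_k w_n(k−1) = Σ_k w_n(k) = r_n(2n), as w_n(0) = w_n(2n) = 0.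
    rowSum-2≡2n : r n 2 ≡ r n (2 * n)
    rowSum-2≡2n = begin
      r n 2                                   ≡⟨ sumℤ-cong (2 * n) (λ k 1≤k k≤2n → row2 k 1≤k k≤2n) ⟩
      sumℤ (2 * n) (λ k → w n (k ∸ 1))        ≡⟨ sym (trans (move-right telescoped) (ℤP.+-identityʳ _)) ⟩
      r n (2 * n)                             ∎
      where
      open ≡-Reasoning
      w-2n : w n (2 * n) ≡ 0ℤ
      w-2n = trans (lastRow-sym (2 * n) 0 (ℕP.+-identityʳ _)) lastRow-0

      telescoped : r n (2 * n) ⊖ sumℤ (2 * n) (λ k → w n (k ∸ 1)) ≡ 0ℤ
      telescoped = begin
        r n (2 * n) ⊖ sumℤ (2 * n) (λ k → w n (k ∸ 1))   ≡⟨ sym (sumℤ-⊖ (2 * n) (w n) (λ k → w n (k ∸ 1))) ⟩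
        sumℤ (2 * n) (λ k → w n k ⊖ w n (k ∸ 1))         ≡⟨ sumℤ-telescope (2 * n) (w n) ⟩
        w n (2 * n) ⊖ w n 0                              ≡⟨ cong₂ _⊖_ w-2n lastRow-0 ⟩
        0ℤ                                               ∎

    -- The defect
    -- X d = r(d) − r(2n+2−d) has zero second difference on [1, 2n) by
    -- 'rowSum-Δ²' and the symmetry of w_n, and vanishes at d = 2n, 2n+1.
    rowSum-sym : ∀ a b → a + b ≡ suc (suc (2 * n)) → r n a ≡ r n b
    rowSum-sym zero    b       refl = trans (r-row0 1≤n) (sym (r-beyond 1≤n (ℕP.m≤n⇒m≤1+n ℕP.≤-refl)))
    rowSum-sym (suc a) zero    a+0≡T = trans (r-beyond 1≤n 2n<a+1) (sym (r-row0 1≤n))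
      where
      2n<a+1 : 2 * n < suc a
      2n<a+1 = subst (2 * n <_) (sym (trans (sym (ℕP.+-identityʳ (suc a))) a+0≡T)) (ℕP.m≤n⇒m≤1+n ℕP.≤-refl)
    rowSum-sym (suc a) (suc b) a+b≡T = ℤP.i-j≡0⇒i≡j (r n (suc a)) (r n (suc b))
      (trans (cong (λ t → r n (suc a) ⊖ r n t) (sym T∸a≡b)) (X-zero (suc a) (s≤s z≤n) a≤2n+1))
      where
      open ≡-Reasoning
      T : ℕ
      T = suc (suc (2 * n))

      a≤2n+1 : suc a ≤ suc (2 * n)
      a≤2n+1 = subst (suc a ≤_) (trans (sym (ℕP.+-suc a b)) (ℕP.suc-injective a+b≡T)) (ℕP.m≤m+n (suc a) b)

      T∸a≡b : T ∸ suc a ≡ suc b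
      T∸a≡b = trans (cong (_∸ suc a) (sym a+b≡T)) (ℕP.m+n∸m≡n (suc a) (suc b))

      X : ℕ → ℤ
      X d = r n d ⊖ r n (T ∸ d)

      X-penultimate : 1 ≤ 2 * n → X (2 * n) ≡ 0ℤ
      X-penultimate _ = begin
        r n (2 * n) ⊖ r n (T ∸ 2 * n)   ≡⟨ cong (λ t → r n (2 * n) ⊖ r n t) (ℕP.m+n∸n≡m 2 (2 * n)) ⟩
        r n (2 * n) ⊖ r n 2             ≡⟨ ℤP.i≡j⇒i-j≡0 (sym rowSum-2≡2n) ⟩
        0ℤ                              ∎

      r-1 : r n 1 ≡ 0ℤ
      r-1 = sumℤ-zero (2 * n) (λ k _ _ → row1-zero k)

      X-top : X (suc (2 * n)) ≡ 0ℤ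
      X-top = begin
        r n (suc (2 * n)) ⊖ r n (T ∸ suc (2 * n))   ≡⟨ cong (λ t → r n (suc (2 * n)) ⊖ r n t) (ℕP.m+n∸n≡m 1 (2 * n)) ⟩
        r n (suc (2 * n)) ⊖ r n 1                   ≡⟨ cong₂ _⊖_ (r-beyond 1≤n ℕP.≤-refl) r-1 ⟩
        0ℤ                                          ∎

      harmonic : ∀ d → 1 ≤ d → d < 2 * n → Δ² X d ≡ 0ℤ
      harmonic d 1≤d d<2n = begin
        Δ² X d
          ≡⟨ Δ²-⊖ (r n) (λ i → r n (T ∸ i)) d ⟩
        Δ² (r n) d ⊖ Δ² (λ i → r n (T ∸ i)) d
          ≡⟨ cong (Δ² (r n) d ⊖_) reflected ⟩
        Δ² (r n) d ⊖ Δ² (r n) (2 * n ∸ d)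
          ≡⟨ cong₂ _⊖_ (rowSum-Δ² d 1≤d d<2n) (rowSum-Δ² (2 * n ∸ d) (1≤∸ d<2n) (suc∸≤ 1≤d d≤2n)) ⟩
        ⊝ twice (w n d) ⊖ ⊝ twice (w n (2 * n ∸ d))
          ≡⟨ cong (λ t → ⊝ twice (w n d) ⊖ ⊝ twice t) (sym (lastRow-sym d (2 * n ∸ d) (ℕP.m+[n∸m]≡n d≤2n))) ⟩
        ⊝ twice (w n d) ⊖ ⊝ twice (w n d)
          ≡⟨ ℤP.+-inverseʳ (⊝ twice (w n d)) ⟩
        0ℤ ∎
        where
        d≤2n : d ≤ 2 * n
        d≤2n = ℕP.<⇒≤ d<2n
        reflected : Δ² (λ i → r n (T ∸ i)) d ≡ Δ² (r n) (2 * n ∸ d)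
        reflected = subst (λ t → Δ² (λ i → r n (t ∸ i)) d ≡ Δ² (r n) (2 * n ∸ d))
                          (cong (suc ∘ suc) (ℕP.m+[n∸m]≡n d≤2n)) (Δ²-reflect (r n) (2 * n ∸ d) d)

      X-zero : ∀ d → 1 ≤ d → d ≤ suc (2 * n) → X d ≡ 0ℤ
      X-zero = Δ²-backward-zero X 1 (2 * n) X-penultimate X-top harmonic

  invariant-step : ∀ N → 1 ≤ N → Invariant N → Invariant (suc N)
  invariant-step N 1≤N I = record
    { row1-zero    = row1-zero⁺
    ; lastCol-zero = lastCol-zero⁺
    ; below        = below⁺
    ; above        = above⁺
    ; rowSum-sym   = rowSum-sym
    ; colSum-shift = colSum-shift
    ; rowSum-Δ²    = rowSum-Δ²
    }
    where
    open LevelStep N 1≤N I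
    open RowSums n 1≤n row1-zero⁺ lastCol-zero⁺ diagonal below⁺ above⁺ lastRow-1 lastRow-sym

  invariant-base : Invariant 1
  invariant-base = record
    { row1-zero    = row1-zero
    ; lastCol-zero = lastCol-zero
    ; below        = below
    ; above        = above
    ; rowSum-sym   = rowSum-sym
    ; colSum-shift = colSum-shift
    ; rowSum-Δ²    = rowSum-Δ²
    }
    where
    1≤1 : 1 ≤ 1
    1≤1 = s≤s z≤n

    2<3+i : ∀ {i} → 2 < suc (suc (suc i))
    2<3+i = s≤s (s≤s (s≤s z≤n))

    row1-zero : ∀ k → F 1 1 k ≡ 0ℤ
    row1-zero zero                = F-col0 1 1≤1
    row1-zero (suc zero)          = cong +_ M1-11
    row1-zero (suc (suc zero))    = cong +_ M1-12
    row1-zero (suc (suc (suc k))) = F-colBeyond 1 1≤1 2<3+i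

    lastCol-zero : ∀ m → F 1 m 2 ≡ 0ℤ
    lastCol-zero zero                = F-row0 2 1≤1
    lastCol-zero (suc zero)          = cong +_ M1-12
    lastCol-zero (suc (suc zero))    = cong +_ M1-22
    lastCol-zero (suc (suc (suc m))) = F-rowBeyond 2 1≤1 2<3+i

    below : ∀ m k → 1 ≤ k → k < m → m ≤ 2 → F 1 m k ≡ F 1 k m ⊕ w 1 (m ∸ k)
    below (suc (suc zero)) (suc zero) _ _ _ = sym (trans (cong (_⊕ F 1 2 1) (cong +_ M1-12)) (ℤP.+-identityˡ _))
    below (suc zero) (suc k) _ (s≤s ()) _
    below (suc (suc zero)) (suc (suc k)) _ (s≤s (s≤s ())) _
    below (suc (suc (suc m))) k _ _ (s≤s (s≤s ()))

    above : ∀ m k → 1 ≤ m → suc (suc m) ≤ k → k ≤ 2 →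
            F 1 (suc m) k ⊕ F 1 m (k ∸ 1) ≡ twice (F 1 m k) ⊕ w 1 (k ∸ m)
    above (suc m) k _ m+3≤k k≤2 = ⊥-elim (ℕP.<⇒≱ (ℕP.≤-trans (s≤s (s≤s (s≤s z≤n))) m+3≤k) k≤2)

    r-1 : r 1 1 ≡ 0ℤ
    r-1 = sumℤ-zero 2 (λ k _ _ → row1-zero k)

    r-2 : r 1 2 ≡ + 1
    r-2 = cong₂ (λ a b → (0ℤ ⊕ + a) ⊕ + b) M1-21 M1-22

    r-beyond′ : ∀ d → 2 < d → r 1 d ≡ 0ℤ
    r-beyond′ d 2<d = r-beyond 1≤1 2<d

    rowSum-sym : ∀ a b → a + b ≡ 4 → r 1 a ≡ r 1 b
    rowSum-sym 0 .4 refl = trans (r-row0 1≤1) (sym (r-beyond′ 4 2<3+i))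
    rowSum-sym 1 .3 refl = trans r-1 (sym (r-beyond′ 3 2<3+i))
    rowSum-sym 2 .2 refl = refl
    rowSum-sym 3 .1 refl = trans (r-beyond′ 3 2<3+i) (sym r-1)
    rowSum-sym 4 .0 refl = trans (r-beyond′ 4 2<3+i) (sym (r-row0 1≤1))
    rowSum-sym (suc (suc (suc (suc (suc a))))) b ()

    colSum-shift : ∀ k → 1 ≤ k → k ≤ 2 → c 1 k ≡ r 1 (suc k)
    colSum-shift 1 _ _ = trans (cong₂ (λ a b → (0ℤ ⊕ + a) ⊕ + b) M1-11 M1-21) (sym r-2)
    colSum-shift 2 _ _ = trans (cong₂ (λ a b → (0ℤ ⊕ + a) ⊕ + b) M1-12 M1-22) (sym (r-beyond′ 3 2<3+i))
    colSum-shift (suc (suc (suc k))) _ (s≤s (s≤s ()))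

    rowSum-Δ² : ∀ d → 1 ≤ d → suc d ≤ 2 → Δ² (r 1) d ≡ ⊝ twice (w 1 d)
    rowSum-Δ² 1 _ _ = begin
      (r 1 1 ⊕ r 1 3) ⊖ twice (r 1 2)   ≡⟨ cong₂ (λ a b → (a ⊕ b) ⊖ twice (r 1 2)) r-1 (r-beyond′ 3 2<3+i) ⟩
      (0ℤ ⊕ 0ℤ) ⊖ twice (r 1 2)         ≡⟨ cong (λ a → (0ℤ ⊕ 0ℤ) ⊖ twice a) r-2 ⟩
      ⊝ twice (+ 1)                      ≡⟨ cong (⊝_ ∘ twice ∘ +_) (sym M1-21) ⟩
      ⊝ twice (w 1 1)                    ∎
      where open ≡-Reasoning
    rowSum-Δ² (suc (suc d)) _ (s≤s (s≤s ()))

  invariant : ∀ n → 1 ≤ n → Invariant n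
  invariant (suc zero)    _ = invariant-base
  invariant (suc (suc N)) _ = invariant-step (suc N) (s≤s z≤n) (invariant (suc N) (s≤s z≤n))

  -- The two identities of the theorem, for j = k − 1, at any level n ≥ 2:
  -- they follow from 'below' (three times, twice with w_n(1) = 0) and 'above'.
  adjacent-identities : ∀ N j → 1 ≤ N → 1 ≤ j → suc (suc j) ≤ 2 * suc N →
    let n = suc N in
    (F n (suc (suc j)) j ⊕ F n j (suc (suc j)) ≡ F n (suc (suc j)) (suc j) ⊕ F n j (suc j)) ×
    (F n (suc (suc j)) (suc j) ⊕ F n j (suc j) ≡ F n (suc j) (suc (suc j)) ⊕ F n (suc j) j)
  adjacent-identities N j 1≤N 1≤j j+2≤2n =
      first (F n j (suc (suc j))) (F n (suc j) (suc (suc j))) (F n j (suc j)) (w n 2) outer upper laplace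
    , second (F n (suc j) (suc (suc j))) (F n j (suc j)) upper lower
    where
    n : ℕ
    n = suc N
    open Invariant (invariant-step N 1≤N (invariant N 1≤N))

    w-gap1 : ∀ i → w n (suc i ∸ i) ≡ 0ℤ
    w-gap1 i = trans (cong (w n) (ℕP.m+n∸n≡m 1 i)) (LevelStep.lastRow-1 N 1≤N (invariant N 1≤N))

    outer : F n (suc (suc j)) j ≡ F n j (suc (suc j)) ⊕ w n 2
    outer = trans (below (suc (suc j)) j 1≤j (ℕP.n≤1+n (suc j)) j+2≤2n)
                  (cong (λ t → F n j (suc (suc j)) ⊕ w n t) (ℕP.m+n∸n≡m 2 j))

    upper : F n (suc (suc j)) (suc j) ≡ F n (suc j) (suc (suc j)) ⊕ 0ℤ
    upper = trans (below (suc (suc j)) (suc j) (s≤s z≤n) ℕP.≤-refl j+2≤2n)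
                  (cong (F n (suc j) (suc (suc j)) ⊕_) (w-gap1 (suc j)))

    lower : F n (suc j) j ≡ F n j (suc j) ⊕ 0ℤ
    lower = trans (below (suc j) j 1≤j ℕP.≤-refl (ℕP.≤-trans (ℕP.n≤1+n (suc j)) j+2≤2n))
                  (cong (F n j (suc j) ⊕_) (w-gap1 j))

    laplace : F n (suc j) (suc (suc j)) ⊕ F n j (suc j) ≡ twice (F n j (suc (suc j))) ⊕ w n 2
    laplace = trans (above j (suc (suc j)) 1≤j ℕP.≤-refl j+2≤2n)
                    (cong (λ t → twice (F n j (suc (suc j))) ⊕ w n t) (ℕP.m+n∸n≡m 2 j))

    first : ∀ {A B} C D E u → A ≡ C ⊕ u → B ≡ D ⊕ 0ℤ → D ⊕ E ≡ twice C ⊕ u → A ⊕ C ≡ B ⊕ E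
    first C D E u refl refl laplace′ = from-difference (key C D E u) (sym laplace′)
      where
      key : ∀ C D E u → ((C ⊕ u) ⊕ C) ⊖ ((D ⊕ 0ℤ) ⊕ E) ≡ ((C ⊕ C) ⊕ u) ⊖ (D ⊕ E)
      key = solve-∀

    second : ∀ {B G} D E → B ≡ D ⊕ 0ℤ → G ≡ E ⊕ 0ℤ → B ⊕ E ≡ D ⊕ G
    second D E refl refl = shuffle D E
      where
      shuffle : ∀ D E → (D ⊕ 0ℤ) ⊕ E ≡ D ⊕ (E ⊕ 0ℤ)
      shuffle = solve-∀

mainTheorem12 : (f : Entries) → IsDelta f →
    ∀ n k → 1 ≤ n → 2 ≤ k → k ≤ 2 * n ∸ 1 →
    (f n (k + 1) (k ∸ 1) + f n (k ∸ 1) (k + 1) ≡ f n (k + 1) k + f n (k ∸ 1) k)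
    × (f n (k + 1) k + f n (k ∸ 1) k ≡ f n k (k + 1) + f n k (k ∸ 1))
mainTheorem12 f delta zero _ () _ _
mainTheorem12 f delta _ zero _ () _
mainTheorem12 f delta _ (suc zero) _ (s≤s ()) _
mainTheorem12 f delta (suc zero)    (suc (suc _)) _ _ (s≤s ())
mainTheorem12 f delta (suc (suc N)) k@(suc (suc i)) _ _ k≤2n∸1 rewrite ℕP.+-comm k 1 =
  let (first , second) = adjacent-identities (suc N) (suc i) (s≤s z≤n) (s≤s z≤n) k+1≤2n
  in  ℤP.+-injective first , ℤP.+-injective second
  where
  open DeltaSequence f delta
  k+1≤2n : suc k ≤ 2 * suc (suc N)
  k+1≤2n = subst (_≤ 2 * suc (suc N)) (ℕP.+-comm k 1) (ℕP.m≤o∸n⇒m+n≤o k (s≤s z≤n) k≤2n∸1)
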